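{- Let $G$ be a mixed graph on $n$ vertices. Then $G$ is $(r,s)$-regular if and only if $2(r+s)$ and $2r$ are eigenvalues of the integrated signless Laplacian matrix $\mathcal{I}^Q(G)$ with corresponding eigenvectors $\mathbf{1}_{2n}$ and $\begin{bmatrix}\mathbf{1}_n^T & -\mathbf{1}_n^T\end{bmatrix}^T$, respectively (where the first $n$ coordinates correspond to $v'_1,\dots,v'_n$ and the last $n$ to $v''_1,\dots,v''_n$).
   Context: A mixed graph $G=(V_G,E_G,\vec{E}_G)$ has a finite vertex set, a multiset $E_G$ of unordered pairs (edges; $\{v,v\}$ is a loop) and a multiset $\vec{E}_G$ of ordered pairs (arcs; $(v,v)$ is a directed loop). $d(v)$ is the number of edges at $v$, loops counted twice; $d^+(v)$ (resp. $d^-(v)$) the number of arcs starting (resp. ending) at $v$, directed loops included. $G$ is $(r,s)$-regular if $d(u)=r$ and $d^+(u)=d^-(u)=s$ for all $u\in V_G$. $\mathbf{1}_m$ is the all-ones column vector of length $m$. For $V_G=\{v_1,\dots,v_n\}$, the integrated adjacency matrix $\mathcal{I}(G)$ is the $2n\times 2n$ matrix indexed by $v'_1,\dots,v'_n,v''_1,\dots,v''_n$ whose $(v'_i,v'_j)$ and $(v''_i,v''_j)$ entries are the number of edges joining $v_i,v_j$ if $i\neq j$ and $2\times$(number of loops at $v_i$) if $i=j$, and whose $(v'_i,v''_j)$ and $(v''_j,v'_i)$ entries are the number of arcs from $v_i$ to $v_j$. The integrated degree matrix $\mathcal{I}^D(G)$ is diagonal with $(v'_i,v'_i)$ entry $d(v_i)+d^+(v_i)$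 and $(v''_i,v''_i)$ entry $d(v_i)+d^-(v_i)$; $\mathcal{I}^Q(G)=\mathcal{I}^D(G)+\mathcal{I}(G)$. -}

module Defs where

open import Data.Nat as ℕ using (ℕ; zero; suc)
open import Data.Integer as ℤ using (ℤ; +_; -_)
open import Data.Fin using (Fin; zero; suc; _≟_)
open import Data.List using (List; []; _∷_)
open import Data.Product using (_×_; _,_; ∃)
open import Data.Sum using (_⊎_; inj₁; inj₂)
open import Data.Bool using (if_then_else_)
open import Relation.Nullary using (does; ¬_)
open import Relation.Binary.PropositionalEquality using (_≡_)

-- Both components are multisets
-- (lists).  An edge {u,v} is stored as a pair (u , v) whose order is
-- irrelevant; a loop at v is (v , v).  An arc (u , v) goes from u to v.
record MixedGraph (n : ℕ) : Set where
  field
    edges : List (Fin n × Fin n)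
    arcs  : List (Fin n × Fin n)
open MixedGraph public

[_≡ᶠ_] : ∀ {n} → Fin n → Fin n → ℕ
[ i ≡ᶠ j ] = if does (i ≟ j) then 1 else 0

-- d(v): number of edges at v, loops counted twice
deg : ∀ {n} → MixedGraph n → Fin n → ℕ
deg G v = go (edges G)
  where
  go : List _ → ℕ
  go [] = 0
  go ((a , b) ∷ es) = [ a ≡ᶠ v ] ℕ.+ [ b ≡ᶠ v ] ℕ.+ go es

-- d⁺(v): arcs starting at v (directed loops included)
outdeg : ∀ {n} → MixedGraph n → Fin n → ℕ
outdeg G v = go (arcs G)
  where
  go : List _ → ℕ
  go [] = 0
  go ((a , b) ∷ es) = [ a ≡ᶠ v ] ℕ.+ go es

-- d⁻(v): arcs ending at v (directed loops included)
indeg : ∀ {n} → MixedGraph n → Fin n → ℕ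
indeg G v = go (arcs G)
  where
  go : List _ → ℕ
  go [] = 0
  go ((a , b) ∷ es) = [ b ≡ᶠ v ] ℕ.+ go es

-- number of edges joining i and j if i ≠ j, and 2 × (number of loops at i)
-- if i = j : each stored edge (a , b) contributes [a=i][b=j] + [a=j][b=i].
edgeEntry : ∀ {n} → MixedGraph n → Fin n → Fin n → ℕ
edgeEntry G i j = go (edges G)
  where
  go : List _ → ℕ
  go [] = 0
  go ((a , b) ∷ es) =
    [ a ≡ᶠ i ] ℕ.* [ b ≡ᶠ j ] ℕ.+ [ a ≡ᶠ j ] ℕ.* [ b ≡ᶠ i ] ℕ.+ go es

arcEntry : ∀ {n} → MixedGraph n → Fin n → Fin n → ℕ
arcEntry G i j = go (arcs G)
  where
  go : List _ → ℕ
  go [] = 0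
  go ((a , b) ∷ es) = [ a ≡ᶠ i ] ℕ.* [ b ≡ᶠ j ] ℕ.+ go es

IsRegular : ∀ {n} → MixedGraph n → ℕ → ℕ → Set
IsRegular {n} G r s =
  (u : Fin n) → deg G u ≡ r × outdeg G u ≡ s × indeg G u ≡ s

-- Index set of the 2n × 2n integrated matrices:
-- inj₁ i = v'ᵢ (first n coordinates), inj₂ i = v''ᵢ (last n coordinates).
Idx : ℕ → Set
Idx n = Fin n ⊎ Fin n

Matrix : ℕ → Set
Matrix n = Idx n → Idx n → ℤ

Vector : ℕ → Set
Vector n = Idx n → ℤ

integratedAdj : ∀ {n} → MixedGraph n → Matrix n
integratedAdj G (inj₁ i) (inj₁ j) = + edgeEntry G i j
integratedAdj G (inj₂ i) (inj₂ j) = + edgeEntry G i j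
integratedAdj G (inj₁ i) (inj₂ j) = + arcEntry G i j
integratedAdj G (inj₂ j) (inj₁ i) = + arcEntry G i j

integratedDeg : ∀ {n} → MixedGraph n → Matrix n
integratedDeg G (inj₁ i) (inj₁ j) =
  if does (i ≟ j) then + (deg G i ℕ.+ outdeg G i) else + 0
integratedDeg G (inj₂ i) (inj₂ j) =
  if does (i ≟ j) then + (deg G i ℕ.+ indeg G i) else + 0
integratedDeg G (inj₁ i) (inj₂ j) = + 0
integratedDeg G (inj₂ i) (inj₁ j) = + 0

integratedQ : ∀ {n} → MixedGraph n → Matrix n
integratedQ G x y = integratedDeg G x y ℤ.+ integratedAdj G x y

∑ : ∀ n → (Fin n → ℤ) → ℤ
∑ zero f = + 0
∑ (suc n) f = f zero ℤ.+ ∑ n (λ i → f (suc i))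

_*ᵥ_ : ∀ {n} → Matrix n → Vector n → Vector n
_*ᵥ_ {n} M x a = ∑ n (λ j → M a (inj₁ j) ℤ.* x (inj₁ j))
             ℤ.+ ∑ n (λ j → M a (inj₂ j) ℤ.* x (inj₂ j))

IsEigenpair : ∀ {n} → Matrix n → ℤ → Vector n → Set
IsEigenpair {n} M μ x =
  (∃ λ (a : Idx n) → ¬ (x a ≡ + 0)) × ((a : Idx n) → (M *ᵥ x) a ≡ μ ℤ.* x a)

ones : ∀ {n} → Vector n
ones _ = + 1

onesNegOnes : ∀ {n} → Vector n
onesNegOnes (inj₁ _) = + 1
onesNegOnes (inj₂ _) = - (+ 1)

-- Summing a row of 𝓘(G) gives d(vᵢ) in the diagonal block and d⁺(vᵢ) (resp. d⁻(vᵢ)) in the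
-- off-diagonal block, so the entries of 𝓘^Q(G)𝟏 at v′ᵢ, v″ᵢ are 2(d + d⁺) and 2(d + d⁻), and those
-- of 𝓘^Q(G)[𝟏; −𝟏] are 2d and −2d. Hence the two eigen-equations say exactly that d = r and
-- d + d⁺ = d + d⁻ = r + s at every vertex, i.e. (r,s)-regularity.
module Submission where

open import Defs
open import Data.Nat using (ℕ; _+_; _*_; _≤_)
open import Data.Integer using (+_)
open import Data.Product using (_×_)
open import Function.Bundles using (_⇔_)

open import Data.Nat using (zero; suc; s≤s)
import Data.Nat.Properties as ℕₚ
open import Data.Integer as ℤ using (ℤ; -_; _-_)
import Data.Integer.Properties as ℤₚ
open import Data.Integer.Tactic.RingSolver using (solve-∀)
open import Data.Fin using (Fin; zero; suc; _≟_)
open import Data.List using (List; []; _∷_)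
open import Data.Product using (_,_; proj₁; proj₂)
open import Data.Sum using (inj₁; inj₂)
open import Data.Bool using (Bool; true; false; if_then_else_)
open import Function.Base using (_∘_)
open import Function.Bundles using (Equivalence; mk⇔)
open import Relation.Nullary using (does)
open import Relation.Binary.PropositionalEquality
open import Algebra.Properties.Semiring.Sum ℕₚ.+-*-semiring
  using (sum; ∑-distrib-+; *-distribˡ-sum; *-distribʳ-sum; sum-replicate-zero)

sum-δ : ∀ {n} (i : Fin n) c → sum (λ j → if does (i ≟ j) then c else 0) ≡ c
sum-δ {suc n} zero c = trans (cong (λ m → c + m) (sum-replicate-zero n)) (ℕₚ.+-identityʳ c)
sum-δ (suc i) c = sum-δ i c

sum-*ˡ-indicator : ∀ {n} c (a : Fin n) → sum (λ j → c * [ a ≡ᶠ j ]) ≡ c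
sum-*ˡ-indicator c a = begin
  sum (λ j → c * [ a ≡ᶠ j ]) ≡⟨ *-distribˡ-sum c (λ j → [ a ≡ᶠ j ]) ⟨
  c * sum (λ j → [ a ≡ᶠ j ])  ≡⟨ cong (c *_) (sum-δ a 1) ⟩
  c * 1                       ≡⟨ ℕₚ.*-identityʳ c ⟩
  c                           ∎
  where open ≡-Reasoning

sum-*ʳ-indicator : ∀ {n} c (a : Fin n) → sum (λ j → [ a ≡ᶠ j ] * c) ≡ c
sum-*ʳ-indicator c a = begin
  sum (λ j → [ a ≡ᶠ j ] * c) ≡⟨ *-distribʳ-sum c (λ j → [ a ≡ᶠ j ]) ⟨
  sum (λ j → [ a ≡ᶠ j ]) * c  ≡⟨ cong (_* c) (sum-δ a 1) ⟩
  1 * c                       ≡⟨ ℕₚ.*-identityˡ c ⟩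
  c                           ∎
  where open ≡-Reasoning

-- deg, edgeEntry, … recurse on one list only, so we induct on that list inside a graph
-- rebuilt around it.
edgeEntry-rowSum : ∀ {n} (G : MixedGraph n) i → sum (edgeEntry G i) ≡ deg G i
edgeEntry-rowSum {n} G i = onEdges (edges G)
  where
  open ≡-Reasoning
  withEdges : List (Fin n × Fin n) → MixedGraph n
  withEdges es = record { edges = es ; arcs = arcs G }
  onEdges : ∀ es → sum (edgeEntry (withEdges es) i) ≡ deg (withEdges es) i
  onEdges [] = sum-replicate-zero n
  onEdges ((a , b) ∷ es) = begin
    sum (λ j → [ a ≡ᶠ i ] * [ b ≡ᶠ j ] + [ a ≡ᶠ j ] * [ b ≡ᶠ i ] + edgeEntry G′ i j)
      ≡⟨ ∑-distrib-+ (λ j → [ a ≡ᶠ i ] * [ b ≡ᶠ j ] + [ a ≡ᶠ j ] * [ b ≡ᶠ i ]) (edgeEntry G′ i) ⟩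
    sum (λ j → [ a ≡ᶠ i ] * [ b ≡ᶠ j ] + [ a ≡ᶠ j ] * [ b ≡ᶠ i ]) + sum (edgeEntry G′ i)
      ≡⟨ cong₂ _+_ (∑-distrib-+ (λ j → [ a ≡ᶠ i ] * [ b ≡ᶠ j ]) (λ j → [ a ≡ᶠ j ] * [ b ≡ᶠ i ]))
                   (onEdges es) ⟩
    sum (λ j → [ a ≡ᶠ i ] * [ b ≡ᶠ j ]) + sum (λ j → [ a ≡ᶠ j ] * [ b ≡ᶠ i ]) + deg G′ i
      ≡⟨ cong (_+ deg G′ i) (cong₂ _+_ (sum-*ˡ-indicator _ b) (sum-*ʳ-indicator _ a)) ⟩
    [ a ≡ᶠ i ] + [ b ≡ᶠ i ] + deg G′ i
      ∎
    where
    G′ : MixedGraph n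
    G′ = withEdges es

arcEntry-rowSum : ∀ {n} (G : MixedGraph n) i → sum (arcEntry G i) ≡ outdeg G i
arcEntry-rowSum {n} G i = onArcs (arcs G)
  where
  withArcs : List (Fin n × Fin n) → MixedGraph n
  withArcs as = record { edges = edges G ; arcs = as }
  onArcs : ∀ as → sum (arcEntry (withArcs as) i) ≡ outdeg (withArcs as) i
  onArcs [] = sum-replicate-zero n
  onArcs ((a , b) ∷ as) =
    trans (∑-distrib-+ (λ j → [ a ≡ᶠ i ] * [ b ≡ᶠ j ]) (arcEntry (withArcs as) i))
          (cong₂ _+_ (sum-*ˡ-indicator _ b) (onArcs as))

arcEntry-colSum : ∀ {n} (G : MixedGraph n) i → sum (λ j → arcEntry G j i) ≡ indeg G i
arcEntry-colSum {n} G i = onArcs (arcs G)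
  where
  withArcs : List (Fin n × Fin n) → MixedGraph n
  withArcs as = record { edges = edges G ; arcs = as }
  onArcs : ∀ as → sum (λ j → arcEntry (withArcs as) j i) ≡ indeg (withArcs as) i
  onArcs [] = sum-replicate-zero n
  onArcs ((a , b) ∷ as) =
    trans (∑-distrib-+ (λ j → [ a ≡ᶠ j ] * [ b ≡ᶠ i ]) (λ j → arcEntry (withArcs as) j i))
          (cong₂ _+_ (sum-*ʳ-indicator _ a) (onArcs as))

∑-cong : ∀ n {f g : Fin n → ℤ} → (∀ j → f j ≡ g j) → ∑ n f ≡ ∑ n g
∑-cong zero    f≗g = refl
∑-cong (suc n) f≗g = cong₂ ℤ._+_ (f≗g zero) (∑-cong n (f≗g ∘ suc))

∑-pos : ∀ n (f : Fin n → ℕ) → ∑ n (+_ ∘ f) ≡ + sum f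
∑-pos zero    f = refl
∑-pos (suc n) f = cong (λ x → + f zero ℤ.+ x) (∑-pos n (f ∘ suc))

∑-neg : ∀ n (f : Fin n → ℤ) → ∑ n (-_ ∘ f) ≡ - ∑ n f
∑-neg zero    f = refl
∑-neg (suc n) f = begin
  - f zero ℤ.+ ∑ n (-_ ∘ f ∘ suc) ≡⟨ cong (λ x → - f zero ℤ.+ x) (∑-neg n (f ∘ suc)) ⟩
  - f zero ℤ.+ - ∑ n (f ∘ suc)    ≡⟨ ℤₚ.neg-distrib-+ (f zero) _ ⟨
  - (f zero ℤ.+ ∑ n (f ∘ suc))    ∎
  where open ≡-Reasoning

i*-1≡-i : ∀ i → i ℤ.* - + 1 ≡ - i
i*-1≡-i i = trans (ℤₚ.*-comm i (- + 1)) (ℤₚ.-1*i≡-i i)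

*ᵥ-ones : ∀ {n} (M : Matrix n) a → (M *ᵥ ones) a ≡ ∑ n (M a ∘ inj₁) ℤ.+ ∑ n (M a ∘ inj₂)
*ᵥ-ones {n} M a =
  cong₂ ℤ._+_ (∑-cong n (ℤₚ.*-identityʳ ∘ M a ∘ inj₁)) (∑-cong n (ℤₚ.*-identityʳ ∘ M a ∘ inj₂))

*ᵥ-onesNegOnes : ∀ {n} (M : Matrix n) a →
  (M *ᵥ onesNegOnes) a ≡ ∑ n (M a ∘ inj₁) - ∑ n (M a ∘ inj₂)
*ᵥ-onesNegOnes {n} M a =
  cong₂ ℤ._+_ (∑-cong n (ℤₚ.*-identityʳ ∘ M a ∘ inj₁))
              (trans (∑-cong n (i*-1≡-i ∘ M a ∘ inj₂)) (∑-neg n (M a ∘ inj₂)))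

pos-if-+ : ∀ (b : Bool) (c e : ℕ) → (if b then + c else + 0) ℤ.+ + e ≡ + ((if b then c else 0) + e)
pos-if-+ true  c e = refl
pos-if-+ false c e = refl

module _ {n} (G : MixedGraph n) (i : Fin n) where
  private
    d o ι : ℕ
    d = deg G i
    o = outdeg G i
    ι = indeg G i
    Q : Matrix n
    Q = integratedQ G

  ∑-diagonalBlock : ∀ c →
    ∑ n (λ j → (if does (i ≟ j) then + c else + 0) ℤ.+ + edgeEntry G i j) ≡ + (c + d)
  ∑-diagonalBlock c = begin
    ∑ n (λ j → (if does (i ≟ j) then + c else + 0) ℤ.+ + edgeEntry G i j)
      ≡⟨ ∑-cong n (λ j → pos-if-+ (does (i ≟ j)) c (edgeEntry G i j)) ⟩
    ∑ n (+_ ∘ δ+E)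
      ≡⟨ ∑-pos n δ+E ⟩
    + sum δ+E
      ≡⟨ cong +_ (∑-distrib-+ δ (edgeEntry G i)) ⟩
    + (sum δ + sum (edgeEntry G i))
      ≡⟨ cong +_ (cong₂ _+_ (sum-δ i c) (edgeEntry-rowSum G i)) ⟩
    + (c + d)
      ∎
    where
    open ≡-Reasoning
    δ δ+E : Fin n → ℕ
    δ j = if does (i ≟ j) then c else 0
    δ+E j = δ j + edgeEntry G i j

  ∑-Q-v′v′ : ∑ n (Q (inj₁ i) ∘ inj₁) ≡ + (d + o + d)
  ∑-Q-v′v′ = ∑-diagonalBlock (d + o)

  ∑-Q-v″v″ : ∑ n (Q (inj₂ i) ∘ inj₂) ≡ + (d + ι + d)
  ∑-Q-v″v″ = ∑-diagonalBlock (d + ι)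

  ∑-Q-v′v″ : ∑ n (Q (inj₁ i) ∘ inj₂) ≡ + o
  ∑-Q-v′v″ = trans (∑-pos n (arcEntry G i)) (cong +_ (arcEntry-rowSum G i))

  ∑-Q-v″v′ : ∑ n (Q (inj₂ i) ∘ inj₁) ≡ + ι
  ∑-Q-v″v′ = trans (∑-pos n (λ j → arcEntry G j i)) (cong +_ (arcEntry-colSum G i))

  Q*ones-v′ : (Q *ᵥ ones) (inj₁ i) ≡ + (2 * (d + o))
  Q*ones-v′ = begin
    (Q *ᵥ ones) (inj₁ i)                              ≡⟨ *ᵥ-ones Q (inj₁ i) ⟩
    ∑ n (Q (inj₁ i) ∘ inj₁) ℤ.+ ∑ n (Q (inj₁ i) ∘ inj₂) ≡⟨ cong₂ ℤ._+_ ∑-Q-v′v′ ∑-Q-v′v″ ⟩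
    + d ℤ.+ + o ℤ.+ + d ℤ.+ + o                       ≡⟨ ring (+ d) (+ o) ⟩
    + 2 ℤ.* (+ d ℤ.+ + o)                             ≡⟨ ℤₚ.pos-* 2 (d + o) ⟨
    + (2 * (d + o))                                   ∎
    where
    open ≡-Reasoning
    ring : ∀ D O → D ℤ.+ O ℤ.+ D ℤ.+ O ≡ + 2 ℤ.* (D ℤ.+ O)
    ring = solve-∀

  Q*ones-v″ : (Q *ᵥ ones) (inj₂ i) ≡ + (2 * (d + ι))
  Q*ones-v″ = begin
    (Q *ᵥ ones) (inj₂ i)                              ≡⟨ *ᵥ-ones Q (inj₂ i) ⟩
    ∑ n (Q (inj₂ i) ∘ inj₁) ℤ.+ ∑ n (Q (inj₂ i) ∘ inj₂) ≡⟨ cong₂ ℤ._+_ ∑-Q-v″v′ ∑-Q-v″v″ ⟩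
    + ι ℤ.+ (+ d ℤ.+ + ι ℤ.+ + d)                     ≡⟨ ring (+ d) (+ ι) ⟩
    + 2 ℤ.* (+ d ℤ.+ + ι)                             ≡⟨ ℤₚ.pos-* 2 (d + ι) ⟨
    + (2 * (d + ι))                                   ∎
    where
    open ≡-Reasoning
    ring : ∀ D I → I ℤ.+ (D ℤ.+ I ℤ.+ D) ≡ + 2 ℤ.* (D ℤ.+ I)
    ring = solve-∀

  Q*onesNegOnes-v′ : (Q *ᵥ onesNegOnes) (inj₁ i) ≡ + (2 * d)
  Q*onesNegOnes-v′ = begin
    (Q *ᵥ onesNegOnes) (inj₁ i)                   ≡⟨ *ᵥ-onesNegOnes Q (inj₁ i) ⟩
    ∑ n (Q (inj₁ i) ∘ inj₁) - ∑ n (Q (inj₁ i) ∘ inj₂) ≡⟨ cong₂ _-_ ∑-Q-v′v′ ∑-Q-v′v″ ⟩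
    (+ d ℤ.+ + o ℤ.+ + d) - + o                   ≡⟨ ring (+ d) (+ o) ⟩
    + 2 ℤ.* + d                                   ≡⟨ ℤₚ.pos-* 2 d ⟨
    + (2 * d)                                     ∎
    where
    open ≡-Reasoning
    ring : ∀ D O → (D ℤ.+ O ℤ.+ D) - O ≡ + 2 ℤ.* D
    ring = solve-∀

  Q*onesNegOnes-v″ : (Q *ᵥ onesNegOnes) (inj₂ i) ≡ - + (2 * d)
  Q*onesNegOnes-v″ = begin
    (Q *ᵥ onesNegOnes) (inj₂ i)                   ≡⟨ *ᵥ-onesNegOnes Q (inj₂ i) ⟩
    ∑ n (Q (inj₂ i) ∘ inj₁) - ∑ n (Q (inj₂ i) ∘ inj₂) ≡⟨ cong₂ _-_ ∑-Q-v″v′ ∑-Q-v″v″ ⟩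
    + ι - (+ d ℤ.+ + ι ℤ.+ + d)                   ≡⟨ ring (+ d) (+ ι) ⟩
    - (+ 2 ℤ.* + d)                               ≡⟨ cong -_ (ℤₚ.pos-* 2 d) ⟨
    - + (2 * d)                                   ∎
    where
    open ≡-Reasoning
    ring : ∀ D I → I - (D ℤ.+ I ℤ.+ D) ≡ - (+ 2 ℤ.* D)
    ring = solve-∀

eigenEntry⇔ : ∀ {y} m k → y ≡ + (2 * m) → (y ≡ + (2 * k) ℤ.* + 1) ⇔ (m ≡ k)
eigenEntry⇔ m k refl = mk⇔
  (λ eq → ℕₚ.*-cancelˡ-≡ m k 2 (ℤₚ.+-injective (trans eq (ℤₚ.*-identityʳ _))))
  (λ { refl → sym (ℤₚ.*-identityʳ _) })

negEigenEntry⇔ : ∀ {y} m k → y ≡ - + (2 * m) → (y ≡ + (2 * k) ℤ.* - + 1) ⇔ (m ≡ k)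
negEigenEntry⇔ m k refl = mk⇔
  (λ eq → ℕₚ.*-cancelˡ-≡ m k 2 (ℤₚ.+-injective (ℤₚ.neg-injective (trans eq (i*-1≡-i _)))))
  (λ { refl → sym (i*-1≡-i _) })

module _ {n} (G : MixedGraph n) (k : ℕ) where
  open Equivalence using (to; from)

  ones-eigen⇔ :
    (∀ a → (integratedQ G *ᵥ ones) a ≡ + (2 * k) ℤ.* ones a) ⇔
    (∀ i → deg G i + outdeg G i ≡ k × deg G i + indeg G i ≡ k)
  ones-eigen⇔ = mk⇔
    (λ eq i → to (v′ i) (eq (inj₁ i)) , to (v″ i) (eq (inj₂ i)))
    (λ { h (inj₁ i) → from (v′ i) (proj₁ (h i)) ; h (inj₂ i) → from (v″ i) (proj₂ (h i)) })
    where
    v′ : ∀ i → ((integratedQ G *ᵥ ones) (inj₁ i) ≡ + (2 * k) ℤ.* + 1) ⇔ (deg G i + outdeg G i ≡ k)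
    v′ i = eigenEntry⇔ _ k (Q*ones-v′ G i)
    v″ : ∀ i → ((integratedQ G *ᵥ ones) (inj₂ i) ≡ + (2 * k) ℤ.* + 1) ⇔ (deg G i + indeg G i ≡ k)
    v″ i = eigenEntry⇔ _ k (Q*ones-v″ G i)

  onesNegOnes-eigen⇔ :
    (∀ a → (integratedQ G *ᵥ onesNegOnes) a ≡ + (2 * k) ℤ.* onesNegOnes a) ⇔
    (∀ i → deg G i ≡ k)
  onesNegOnes-eigen⇔ = mk⇔
    (λ eq i → to (eigenEntry⇔ _ k (Q*onesNegOnes-v′ G i)) (eq (inj₁ i)))
    (λ { h (inj₁ i) → from (eigenEntry⇔ _ k (Q*onesNegOnes-v′ G i)) (h i)
       ; h (inj₂ i) → from (negEigenEntry⇔ _ k (Q*onesNegOnes-v″ G i)) (h i) })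

regular⇔ : ∀ {n} (G : MixedGraph n) r s →
  IsRegular G r s ⇔
    ((∀ i → deg G i + outdeg G i ≡ r + s × deg G i + indeg G i ≡ r + s) × (∀ i → deg G i ≡ r))
regular⇔ G r s = mk⇔
  (λ reg → (λ i → sums (reg i)) , (λ i → proj₁ (reg i)))
  (λ (sums , d≡r) u → d≡r u , cancel (d≡r u) (proj₁ (sums u)) , cancel (d≡r u) (proj₂ (sums u)))
  where
  sums : ∀ {d o ι} → d ≡ r × o ≡ s × ι ≡ s → d + o ≡ r + s × d + ι ≡ r + s
  sums (d≡r , o≡s , ι≡s) = cong₂ _+_ d≡r o≡s , cong₂ _+_ d≡r ι≡s
  cancel : ∀ {d x} → d ≡ r → d + x ≡ r + s → x ≡ s
  cancel refl = ℕₚ.+-cancelˡ-≡ r _ _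

theorem4p5 : (n : ℕ) → 1 ≤ n → (G : MixedGraph n) (r s : ℕ) →
    IsRegular G r s ⇔
      (IsEigenpair (integratedQ G) (+ (2 * (r + s))) ones
        × IsEigenpair (integratedQ G) (+ (2 * r)) onesNegOnes)
theorem4p5 n (s≤s _) G r s = mk⇔
  (λ reg → let (sums , d≡r) = to (regular⇔ G r s) reg in
    ((inj₁ zero , λ ()) , from (ones-eigen⇔ G (r + s)) sums)
    , ((inj₁ zero , λ ()) , from (onesNegOnes-eigen⇔ G r) d≡r))
  (λ ((_ , onesEq) , (_ , onesNegOnesEq)) → from (regular⇔ G r s)
    (to (ones-eigen⇔ G (r + s)) onesEq , to (onesNegOnes-eigen⇔ G r) onesNegOnesEq))
  where
  open Equivalence using (to; from)
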